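{- Let $G$ be a connected graph with $fix(G)=F_{xt}(G)$. Then no class of any fixatic partition of $V(G)$ is a singleton set.
   Context: All graphs are finite, simple; throughout the paper graphs are assumed connected and symmetric (nontrivial automorphism group). A fixing set of $G$ is a set $F\subseteq V(G)$ such that the only automorphism fixing every vertex of $F$ is the identity; $fix(G)$ is the minimum size of a fixing set. A fixatic partition of $G$ is a partition of $V(G)$ into classes each of which is a fixing set; $F_{xt}(G)$ is the maximum number of classes in a fixatic partition. -}

module Defs where

open import Data.Nat using (ℕ; _≤_)
open import Data.Bool using (Bool; true; false)
open import Data.Fin using (Fin)
open import Data.Fin.Subset using (Subset; _∈_; ∣_∣)
open import Data.Fin.Permutation using (Permutation′; _⟨$⟩ʳ_)
open import Data.Product using (Σ; ∃; _×_; _,_)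
open import Function using (Surjective)
open import Relation.Binary.PropositionalEquality using (_≡_; _≢_)
open import Relation.Nullary using (¬_)

record Graph (n : ℕ) : Set where
  field
    adj   : Fin n → Fin n → Bool
    sym   : ∀ u v → adj u v ≡ adj v u
    irrefl : ∀ v → adj v v ≡ false
open Graph public

data Reachable {n : ℕ} (G : Graph n) : Fin n → Fin n → Set where
  here : ∀ {v} → Reachable G v v
  step : ∀ {u w v} → adj G u w ≡ true → Reachable G w v → Reachable G u v

Connected : ∀ {n} → Graph n → Set
Connected G = ∀ u v → Reachable G u v

IsAutomorphism : ∀ {n} → Graph n → Permutation′ n → Set
IsAutomorphism G σ = ∀ u v → adj G (σ ⟨$⟩ʳ u) (σ ⟨$⟩ʳ v) ≡ adj G u v

SymmetricGraph : ∀ {n} → Graph n → Set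
SymmetricGraph {n} G = Σ (Permutation′ n) λ σ → IsAutomorphism G σ × ∃ λ v → σ ⟨$⟩ʳ v ≢ v

IsFixingSet : ∀ {n} → Graph n → (Fin n → Set) → Set
IsFixingSet {n} G F = (σ : Permutation′ n) → IsAutomorphism G σ →
  (∀ v → F v → σ ⟨$⟩ʳ v ≡ v) → ∀ v → σ ⟨$⟩ʳ v ≡ v

IsFix : ∀ {n} → Graph n → ℕ → Set
IsFix {n} G k =
  (Σ (Subset n) λ F → IsFixingSet G (_∈ F) × ∣ F ∣ ≡ k) ×
  ((F : Subset n) → IsFixingSet G (_∈ F) → k ≤ ∣ F ∣)

-- A partition of V(G) into k (nonempty) classes, given by a surjective
-- class-assignment map; class i is {v | c v ≡ i}.
IsFixaticPartition : ∀ {n k} → Graph n → (Fin n → Fin k) → Set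
IsFixaticPartition G c = Surjective _≡_ _≡_ c × (∀ i → IsFixingSet G (λ v → c v ≡ i))

IsFxt : ∀ {n} → Graph n → ℕ → Set
IsFxt {n} G k =
  (Σ (Fin n → Fin k) λ c → IsFixaticPartition G c) ×
  (∀ k′ (c : Fin n → Fin k′) → IsFixaticPartition G c → k′ ≤ k)

SingletonClass : ∀ {n k} → (Fin n → Fin k) → Fin k → Set
SingletonClass {n} c i = ∃ λ v → c v ≡ i × (∀ u → c u ≡ i → u ≡ v)

module Submission where

-- Suppose class i of a fixatic partition c of G into k classes is
-- the singleton {v}.  Any set containing a fixing set is again a fixing set,
-- so {v} itself is a fixing set and hence fix(G) ≤ 1.  Since the partition
-- is fixatic, k ≤ F_xt(G) = fix(G) ≤ 1, so c has a single class; that class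
-- is {v}, hence every vertex equals v.  A graph with only one vertex has no
-- nontrivial automorphism, contradicting that G is symmetric.
--
-- The theorem then chains these facts.

open import Defs
open import Data.Nat using (ℕ; _≤_; s≤s; z≤n)
open import Data.Nat.Properties using (≤-trans)
open import Data.Fin using (Fin; zero)
open import Data.Fin.Subset using (Subset; ⁅_⁆; _∈_; ∣_∣)
open import Data.Fin.Permutation using (_⟨$⟩ʳ_)
open import Data.Fin.Subset.Properties using (x∈⁅x⁆; ∣⁅x⁆∣≡1)
open import Data.Product using (_,_; proj₂)
open import Relation.Nullary using (¬_)
open import Relation.Binary.PropositionalEquality using (_≡_; refl; trans; subst)
  renaming (sym to ≡-sym)

fixingSet-superset : ∀ {n} (G : Graph n) {F F′ : Fin n → Set} →
  (∀ v → F v → F′ v) → IsFixingSet G F → IsFixingSet G F′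
fixingSet-superset G F⊆F′ fixF σ aut fixesF′ =
  fixF σ aut (λ v v∈F → fixesF′ v (F⊆F′ v v∈F))

fix≤fixingSet : ∀ {n} (G : Graph n) {f} → IsFix G f →
  (F : Subset n) → IsFixingSet G (_∈ F) → f ≤ ∣ F ∣
fix≤fixingSet G isFix = proj₂ isFix

fix≤1 : ∀ {n} (G : Graph n) {f} → IsFix G f →
  (v : Fin n) → IsFixingSet G (_∈ ⁅ v ⁆) → f ≤ 1
fix≤1 G isFix v fixV = subst (_ ≤_) (∣⁅x⁆∣≡1 v) (fix≤fixingSet G isFix ⁅ v ⁆ fixV)

classes≤Fxt : ∀ {n} (G : Graph n) {f k} → IsFxt G f →
  (c : Fin n → Fin k) → IsFixaticPartition G c → k ≤ f
classes≤Fxt G isFxt c partition = proj₂ isFxt _ c partition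

fin≤1-unique : ∀ {k} → k ≤ 1 → (a b : Fin k) → a ≡ b
fin≤1-unique (s≤s z≤n) zero zero = refl

oneVertex⇒¬symmetric : ∀ {n} (G : Graph n) (v : Fin n) →
  (∀ u → u ≡ v) → ¬ SymmetricGraph G
oneVertex⇒¬symmetric G v all≡v (σ , _ , w , σw≢w) =
  σw≢w (trans (all≡v (σ ⟨$⟩ʳ w)) (≡-sym (all≡v w)))

mainTheorem11 : ∀ {n} (G : Graph n) → Connected G → SymmetricGraph G →
    (f : ℕ) → IsFix G f → IsFxt G f →
    ∀ {k} (c : Fin n → Fin k) → IsFixaticPartition G c →
    ∀ i → ¬ SingletonClass c i
mainTheorem11 G _ symmetric f isFix isFxt {k} c partition i (v , _ , onlyV) =
  oneVertex⇒¬symmetric G v all≡v symmetric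
  where
  singletonFixing : IsFixingSet G (_∈ ⁅ v ⁆)
  singletonFixing = fixingSet-superset G
    (λ u cu≡i → subst (_∈ ⁅ v ⁆) (≡-sym (onlyV u cu≡i)) (x∈⁅x⁆ v))
    (proj₂ partition i)

  -- k ≤ F_xt(G) = fix(G) ≤ 1
  oneClass : k ≤ 1
  oneClass = ≤-trans (classes≤Fxt G isFxt c partition) (fix≤1 G isFix v singletonFixing)

  all≡v : ∀ u → u ≡ v
  all≡v u = onlyV u (fin≤1-unique oneClass (c u) i)
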